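{- Let $G$ be a $3$-non-compliant graph. Then for any two distinct non-adjacent vertices $u,v$ of $G$, $|N_G(u)\cap N_G(v)|\ge 3$.
   Context: All graphs are finite, simple and undirected; $\overline{G}$ denotes the complement of $G$; $N_G(u)$ is the set of vertices adjacent to $u$. A minor of $G$ is a graph obtained from $G$ by a sequence of vertex deletions, edge deletions and edge contractions. $\Delta(H)$ is the maximum degree of $H$. A graph $G$ on $n$ vertices is $3$-non-compliant if neither $G$ nor $\overline{G}$ has a minor $H$ with $\Delta(H)\ge n-3$. -}

module Defs where

open import Data.Nat using (ℕ; zero; suc; _∸_; _≤_; _⊔_; _+_)
open import Data.Fin using (Fin; punchIn; _≟_)
open import Data.Bool using (Bool; true; false; not; _∧_; _∨_; if_then_else_)
open import Data.List using (List; map; foldr)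
open import Data.Bool.ListAction using (any)
open import Data.Nat.ListAction using (sum)
open import Data.List using () renaming (allFin to allFinL)
open import Data.Product using (Σ; _×_; ∃)
open import Relation.Nullary using (¬_; does)
open import Relation.Binary.PropositionalEquality using (_≡_)

Adj : ℕ → Set
Adj n = Fin n → Fin n → Bool

_==_ : ∀ {n} → Fin n → Fin n → Bool
x == y = does (x ≟ y)

record IsSimple {n : ℕ} (G : Adj n) : Set where
  field
    symm   : ∀ x y → G x y ≡ G y x
    noLoop : ∀ x → G x x ≡ false

complement : ∀ {n} → Adj n → Adj n
complement G x y = not (x == y) ∧ not (G x y)

deleteVertex : ∀ {n} → Fin (suc n) → Adj (suc n) → Adj n
deleteVertex i G x y = G (punchIn i x) (punchIn i y)

deleteEdge : ∀ {n} → Fin n → Fin n → Adj n → Adj n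
deleteEdge a b G x y =
  G x y ∧ not (((x == a) ∧ (y == b)) ∨ ((x == b) ∧ (y == a)))

-- Edge contraction of the edge {a,b}: vertex b is merged into a.
-- Vertices of the result are those of G other than b, indexed via punchIn b.
contract : ∀ {n} → Fin (suc n) → Fin (suc n) → Adj (suc n) → Adj n
contract {n} a b G x y =
  not (x == y) ∧
  any (λ w → any (λ w' → inClass x w ∧ inClass y w' ∧ G w w') (allFinL (suc n)))
      (allFinL (suc n))
  where
  rep : Fin (suc n) → Fin (suc n)
  rep w = if w == b then a else w
  inClass : Fin n → Fin (suc n) → Bool
  inClass z w = rep w == punchIn b z

data Minor : ∀ {m n} → Adj m → Adj n → Set where
  done   : ∀ {n} {G : Adj n} → Minor G G
  delV   : ∀ {m n} {H : Adj m} {G : Adj (suc n)} (i : Fin (suc n)) →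
           Minor H (deleteVertex i G) → Minor H G
  delE   : ∀ {m n} {H : Adj m} {G : Adj n} (a b : Fin n) →
           G a b ≡ true → Minor H (deleteEdge a b G) → Minor H G
  contr  : ∀ {m n} {H : Adj m} {G : Adj (suc n)} (a b : Fin (suc n)) →
           G a b ≡ true → Minor H (contract a b G) → Minor H G

countV : ∀ {n} → (Fin n → Bool) → ℕ
countV {n} p = sum (map (λ w → if p w then 1 else 0) (allFinL n))

degree : ∀ {n} → Adj n → Fin n → ℕ
degree G v = countV (G v)

-- Maximum degree (0 for the empty graph).
maxDegree : ∀ {n} → Adj n → ℕ
maxDegree {n} G = foldr _⊔_ 0 (map (degree G) (allFinL n))

HasMinorMaxDeg≥ : ∀ {n} → Adj n → ℕ → Set
HasMinorMaxDeg≥ G k = Σ ℕ (λ m → Σ (Adj m) (λ H → Minor H G × k ≤ maxDegree H))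

NonCompliant3 : ∀ {n} → Adj n → Set
NonCompliant3 {n} G =
  ¬ HasMinorMaxDeg≥ G (n ∸ 3) × ¬ HasMinorMaxDeg≥ (complement G) (n ∸ 3)

commonNeighbours : ∀ {n} → Adj n → Fin n → Fin n → ℕ
commonNeighbours G u v = countV (λ w → G u w ∧ G v w)

{-# OPTIONS --safe #-}
-- Let n = k + 2 and let u, v be non-adjacent with at most two common neighbours.
-- With at most one, contracting the edge uv of the complement gives a vertex adjacent to all
-- but at most one of the other n - 2 vertices. With exactly two, a and b: if some w ∉ {a, b}
-- sees neither a nor b, then w, not being a common neighbour, misses u (say), and contracting
-- the connected set {u, w, v} of the complement gives a vertex adjacent to all n - 3 others,
-- since w covers a and b and u or v covers the rest; otherwise {a, b} dominates G and
-- contracting the path a–u–b of G does the same.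
module Submission where

open import Defs
open import Data.Nat using (ℕ; zero; suc; _≤_; _+_; _∸_; _⊔_; z≤n; s≤s; _≤?_)
open import Data.Nat.Properties
  using (≤-trans; ≤-reflexive; ≤-pred; m≤m+n; m≤m⊔n; m≤n⊔m; m≤n⇒m≤1+n; +-comm; +-assoc; +-suc;
         +-monoʳ-≤; ∸-monoʳ-≤; m≤n+o⇒m∸n≤o; ≰⇒>; m≤n⇒m<n∨m≡n; suc-injective; module ≤-Reasoning)
open import Data.Fin using (Fin; zero; suc; punchIn; punchOut; _≟_)
open import Data.Fin.Properties as Fin
  using (punchIn-injective; punchInᵢ≢i; punchIn-punchOut; punchOut-injective; any?)
open import Data.Bool using (Bool; true; false; not; _∧_; if_then_else_)
open import Data.Bool.Properties using (if-eta; if-cong; ∧-comm; ∧-conicalˡ; ∧-conicalʳ; T-≡)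
  renaming (_≟_ to _≟ᵇ_)
open import Data.Bool.ListAction using (any)
open import Data.List using (foldr; tabulate; allFin)
open import Data.List.Properties using (map-tabulate)
open import Data.List.Membership.Propositional using (lose)
open import Data.List.Membership.Propositional.Properties using (∈-allFin)
open import Data.List.Relation.Unary.Any.Properties using (any⁺)
open import Data.Nat.ListAction using (sum)
open import Data.Product using (_×_; _,_; ∃; ∃₂)
open import Data.Sum as Sum using (_⊎_; inj₁; inj₂; [_,_]; assocˡ)
open import Data.Empty using (⊥-elim)
open import Function using (_∘_; Equivalence)
open import Relation.Nullary using (yes; no; ¬?; contradiction; _×-dec_)
open import Relation.Nullary.Decidable using (dec-true; dec-false)
open import Relation.Binary.PropositionalEquality
  using (_≡_; _≢_; refl; sym; trans; cong; cong₂; subst; ≢-sym; module ≡-Reasoning)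

toℕ : Bool → ℕ
toℕ b = if b then 1 else 0

count : ∀ {n} → (Fin n → Bool) → ℕ
count p = sum (tabulate (toℕ ∘ p))

countV≡count : ∀ {n} (p : Fin n → Bool) → countV p ≡ count p
countV≡count p = cong sum (map-tabulate (λ x → x) (toℕ ∘ p))

count≡0 : ∀ {n} {p : Fin n → Bool} → count p ≡ 0 → ∀ t → p t ≡ false
count≡0 {suc n} {p} c t with p zero in p0 | t
... | false | zero   = p0
... | false | suc t′ = count≡0 c t′

count≡1 : ∀ {n} {p : Fin n → Bool} → count p ≡ 1 →
          ∃ λ a → p a ≡ true × (∀ t → t ≢ a → p t ≡ false)
count≡1 {suc n} {p} c with p zero in p0
... | true  = zero , p0 , λ where
  zero    0≢0 → contradiction refl 0≢0
  (suc t) _   → count≡0 (suc-injective c) t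
... | false with count≡1 c
...   | a , pa , others = suc a , pa , λ where
  zero    _   → p0
  (suc t) t≢a → others t (t≢a ∘ cong suc)

count≡2 : ∀ {n} {p : Fin n → Bool} → count p ≡ 2 →
          ∃₂ λ a b → a ≢ b × p a ≡ true × p b ≡ true × (∀ t → t ≢ a → t ≢ b → p t ≡ false)
count≡2 {suc n} {p} c with p zero in p0
... | true with count≡1 (suc-injective c)
...   | b , pb , others = zero , suc b , (λ ()) , p0 , pb , λ where
  zero    0≢0 _   → contradiction refl 0≢0
  (suc t) _   t≢b → others t (t≢b ∘ cong suc)
count≡2 {suc n} {p} c | false with count≡2 c
...   | a , b , a≢b , pa , pb , others = suc a , suc b , a≢b ∘ Fin.suc-injective , pa , pb , λ where
  zero    _   _   → p0
  (suc t) t≢a t≢b → others t (t≢a ∘ cong suc) (t≢b ∘ cong suc)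

count-false : ∀ {n} → count {n} (λ _ → false) ≡ 0
count-false {zero}  = refl
count-false {suc n} = count-false {n}

count-mono : ∀ {n} {p q : Fin n → Bool} → (∀ x → p x ≡ true → q x ≡ true) → count p ≤ count q
count-mono {zero}          _   = z≤n
count-mono {suc n} {p} {q} p⇒q with p zero in p0 | q zero in q0
... | true  | true  = s≤s (count-mono (p⇒q ∘ suc))
... | true  | false = contradiction (trans (sym (p⇒q zero p0)) q0) λ ()
... | false | true  = m≤n⇒m≤1+n (count-mono (p⇒q ∘ suc))
... | false | false = count-mono (p⇒q ∘ suc)

count+count-not : ∀ {n} (p : Fin n → Bool) → count p + count (not ∘ p) ≡ n
count+count-not {zero}  p = refl
count+count-not {suc n} p with p zero
... | true  = cong suc (count+count-not (p ∘ suc))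
... | false = trans (+-suc _ _) (cong suc (count+count-not (p ∘ suc)))

count-punchIn : ∀ {n} (p : Fin (suc n) → Bool) i → count p ≡ count (p ∘ punchIn i) + toℕ (p i)
count-punchIn p zero = +-comm (toℕ (p zero)) (count (p ∘ suc))
count-punchIn {suc n} p (suc i) = begin
  toℕ (p zero) + count (p ∘ suc)                                 ≡⟨ cong (toℕ (p zero) +_) (count-punchIn (p ∘ suc) i) ⟩
  toℕ (p zero) + (count (p ∘ suc ∘ punchIn i) + toℕ (p (suc i))) ≡⟨ +-assoc (toℕ (p zero)) _ _ ⟨
  toℕ (p zero) + count (p ∘ suc ∘ punchIn i) + toℕ (p (suc i))   ∎
  where open ≡-Reasoning

count-punchIn-≤ : ∀ {n} (p : Fin (suc n) → Bool) i → count (p ∘ punchIn i) ≤ count p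
count-punchIn-≤ p i = ≤-trans (m≤m+n _ _) (≤-reflexive (sym (count-punchIn p i)))

count-≤-suc-punchIn : ∀ {n} (p : Fin (suc n) → Bool) i → count p ≤ suc (count (p ∘ punchIn i))
count-≤-suc-punchIn p i with p i | count-punchIn p i
... | true  | c = ≤-reflexive (trans c (+-comm _ 1))
... | false | c = m≤n⇒m≤1+n (≤-reflexive (trans c (+-comm _ 0)))

≤-foldr-⊔-tabulate : ∀ {n} (f : Fin n → ℕ) i → f i ≤ foldr _⊔_ 0 (tabulate f)
≤-foldr-⊔-tabulate f zero    = m≤m⊔n (f zero) _
≤-foldr-⊔-tabulate f (suc i) = ≤-trans (≤-foldr-⊔-tabulate (f ∘ suc) i) (m≤n⊔m (f zero) _)

degree≤maxDegree : ∀ {n} (H : Adj n) z → degree H z ≤ maxDegree H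
degree≤maxDegree H z =
  subst (degree H z ≤_) (sym (cong (foldr _⊔_ 0) (map-tabulate (λ x → x) (degree H))))
        (≤-foldr-⊔-tabulate (degree H) z)

Dominates : ∀ {n} → Adj n → Fin n → (Fin n → Bool) → Set
Dominates H z e = ∀ y → y ≢ z → H z y ≡ true ⊎ e y ≡ true

dominates⇒degree≥ : ∀ {m} (H : Adj m) z e → Dominates H z e → m ∸ suc (count e) ≤ degree H z
dominates⇒degree≥ {suc m} H z e dominates = m≤n+o⇒m∸n≤o (suc m) (suc (count e)) (begin
  suc m                                             ≡⟨ count+count-not (H z) ⟨
  count (H z) + count (not ∘ H z)                   ≤⟨ +-monoʳ-≤ _ (count-≤-suc-punchIn (not ∘ H z) z) ⟩
  count (H z) + suc (count (not ∘ H z ∘ punchIn z)) ≤⟨ +-monoʳ-≤ _ (s≤s (count-mono non-neighbour-excepted)) ⟩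
  count (H z) + suc (count (e ∘ punchIn z))         ≤⟨ +-monoʳ-≤ _ (s≤s (count-punchIn-≤ e z)) ⟩
  count (H z) + suc (count e)                       ≡⟨ +-comm (count (H z)) _ ⟩
  suc (count e) + count (H z)                       ≡⟨ cong (suc (count e) +_) (countV≡count (H z)) ⟨
  suc (count e) + degree H z                        ∎)
  where
  open ≤-Reasoning
  non-neighbour-excepted : ∀ y → not (H z (punchIn z y)) ≡ true → e (punchIn z y) ≡ true
  non-neighbour-excepted y nonadj with dominates (punchIn z y) (punchInᵢ≢i z y)
  ... | inj₁ adj = contradiction (trans (sym (cong not adj)) nonadj) λ ()
  ... | inj₂ ey  = ey

==-true : ∀ {n} {x y : Fin n} → x ≡ y → (x == y) ≡ true
==-true {x = x} {y} = dec-true (x ≟ y)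

==-false : ∀ {n} {x y : Fin n} → x ≢ y → (x == y) ≡ false
==-false {x = x} {y} = dec-false (x ≟ y)

any-allFin : ∀ {n} (p : Fin n → Bool) i → p i ≡ true → any p (allFin n) ≡ true
any-allFin p i pi = Equivalence.to T-≡ (any⁺ p (lose (∈-allFin i) (Equivalence.from T-≡ pi)))

-- In contract a b G the merged vertex is a, renamed punchOut b≢a once b is deleted.
module _ {m} (a b : Fin (suc m)) (G : Adj (suc m)) where

  contract-intro : ∀ {x y} w w′ → x ≢ y →
                   (if w == b then a else w) ≡ punchIn b x → (if w′ == b then a else w′) ≡ punchIn b y →
                   G w w′ ≡ true → contract a b G x y ≡ true
  contract-intro w w′ x≢y w∈x w′∈y Gww′ =
    cong₂ _∧_ (cong not (==-false x≢y))
              (any-allFin _ w (any-allFin _ w′ (cong₂ _∧_ (==-true w∈x) (cong₂ _∧_ (==-true w′∈y) Gww′))))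

  punchIn-represents-itself : ∀ y → (if punchIn b y == b then a else punchIn b y) ≡ punchIn b y
  punchIn-represents-itself y = if-cong (==-false (punchInᵢ≢i b y))

  contract-merged : (b≢a : b ≢ a) → ∀ {y} → y ≢ punchOut b≢a →
                    G a (punchIn b y) ≡ true ⊎ G b (punchIn b y) ≡ true →
                    contract a b G (punchOut b≢a) y ≡ true
  contract-merged b≢a {y} y≢z (inj₁ Ga) =
    contract-intro a _ (≢-sym y≢z) (trans (if-eta (a == b)) (sym (punchIn-punchOut b≢a)))
                   (punchIn-represents-itself y) Ga
  contract-merged b≢a {y} y≢z (inj₂ Gb) =
    contract-intro b _ (≢-sym y≢z) (trans (if-cong (==-true {x = b} refl)) (sym (punchIn-punchOut b≢a)))
                   (punchIn-represents-itself y) Gb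

  contract-preserves : ∀ {x y} → x ≢ y → G (punchIn b x) (punchIn b y) ≡ true → contract a b G x y ≡ true
  contract-preserves {x} {y} x≢y =
    contract-intro _ _ x≢y (punchIn-represents-itself x) (punchIn-represents-itself y)

contract-minor : ∀ {m k} {G : Adj (suc m)} {a b} → G a b ≡ true →
                 HasMinorMaxDeg≥ (contract a b G) k → HasMinorMaxDeg≥ G k
contract-minor Gab (_ , H , H≼ , deg) = _ , H , contr _ _ Gab H≼ , deg

punchIn≢ : ∀ {m} {q p : Fin (suc m)} (q≢p : q ≢ p) {y} → y ≢ punchOut q≢p → punchIn q y ≢ p
punchIn≢ {q = q} q≢p {y} y≢z eq = y≢z (punchIn-injective q y _ (trans eq (sym (punchIn-punchOut q≢p))))

dominating-edge⇒minor : ∀ {m j} {G : Adj (suc m)} {p q} e → p ≢ q → G p q ≡ true →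
                        (∀ t → t ≢ p → t ≢ q → G p t ≡ true ⊎ G q t ≡ true ⊎ e t ≡ true) →
                        count e ≤ j → HasMinorMaxDeg≥ G (m ∸ suc j)
dominating-edge⇒minor {m} {j} {G} {p} {q} e p≢q Gpq covered e≤j = contract-minor Gpq (_ , H , done , (begin
  m ∸ suc j                           ≤⟨ ∸-monoʳ-≤ m (s≤s (≤-trans (count-punchIn-≤ e q) e≤j)) ⟩
  m ∸ suc (count (e ∘ punchIn q))     ≤⟨ dominates⇒degree≥ H z (e ∘ punchIn q) dominates ⟩
  degree H z                          ≤⟨ degree≤maxDegree H z ⟩
  maxDegree H                         ∎))
  where
  open ≤-Reasoning
  q≢p : q ≢ p
  q≢p = ≢-sym p≢q
  H : Adj m
  H = contract p q G
  z : Fin m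
  z = punchOut q≢p
  dominates : Dominates H z (e ∘ punchIn q)
  dominates y y≢z =
    Sum.map₁ (contract-merged p q G q≢p y≢z) (assocˡ (covered (punchIn q y) (punchIn≢ q≢p y≢z) (punchInᵢ≢i q y)))

dominating-path⇒minor : ∀ {m} {G : Adj (suc (suc m))} {p q r} → p ≢ q → p ≢ r → q ≢ r →
                        G p q ≡ true → G p r ≡ true ⊎ G q r ≡ true →
                        (∀ t → t ≢ p → t ≢ q → t ≢ r → G p t ≡ true ⊎ G q t ≡ true ⊎ G r t ≡ true) →
                        HasMinorMaxDeg≥ G (m ∸ 1)
dominating-path⇒minor {m} {G} {p} {q} {r} p≢q p≢r q≢r Gpq Gr covered =
  contract-minor Gpq
    (dominating-edge⇒minor (λ _ → false) (≢-sym r′≢z) Hzr′ covered′ (≤-reflexive (count-false {suc m})))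
  where
  q≢p : q ≢ p
  q≢p = ≢-sym p≢q
  H : Adj (suc m)
  H = contract p q G
  z r′ : Fin (suc m)
  z  = punchOut q≢p
  r′ = punchOut q≢r
  r′≢z : r′ ≢ z
  r′≢z = ≢-sym p≢r ∘ punchOut-injective q≢r q≢p
  Hzr′ : H z r′ ≡ true
  Hzr′ = contract-merged p q G q≢p r′≢z
           (subst (λ t → G p t ≡ true ⊎ G q t ≡ true) (sym (punchIn-punchOut q≢r)) Gr)
  covered′ : ∀ s → s ≢ z → s ≢ r′ → H z s ≡ true ⊎ H r′ s ≡ true ⊎ false ≡ true
  covered′ s s≢z s≢r′ =
    Sum.map (contract-merged p q G q≢p s≢z)
            (inj₁ ∘ contract-preserves p q G (≢-sym s≢r′)
                  ∘ subst (λ t → G t (punchIn q s) ≡ true) (sym (punchIn-punchOut q≢r)))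
            (assocˡ (covered (punchIn q s) (punchIn≢ q≢p s≢z) (punchInᵢ≢i q s) (punchIn≢ q≢r s≢r′)))

∧≡false : ∀ x {y} → x ∧ y ≡ false → x ≡ false ⊎ y ≡ false
∧≡false false _  = inj₁ refl
∧≡false true  eq = inj₂ eq

adjacent⇒≢ : ∀ {n} {G : Adj n} → IsSimple G → ∀ {x y} → G x y ≡ true → x ≢ y
adjacent⇒≢ simple {x} Gxy refl = contradiction (trans (sym Gxy) (IsSimple.noLoop simple x)) λ ()

neighbour≢non-neighbour : ∀ {n} (G : Adj n) {x w a} → G x a ≡ true → G w a ≡ false → x ≢ w
neighbour≢non-neighbour G Gxa Gwa refl = contradiction (trans (sym Gxa) Gwa) λ ()

complement-adjacent : ∀ {n} (G : Adj n) {x y} → x ≢ y → G x y ≡ false → complement G x y ≡ true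
complement-adjacent G x≢y Gxy = cong₂ _∧_ (cong not (==-false x≢y)) (cong not Gxy)

non-common-neighbour : ∀ {n} (G : Adj n) {x y t} → x ≢ t → y ≢ t → G x t ∧ G y t ≡ false →
                       complement G x t ≡ true ⊎ complement G y t ≡ true
non-common-neighbour G {x} {t = t} x≢t y≢t not-common =
  Sum.map (complement-adjacent G x≢t) (complement-adjacent G y≢t) (∧≡false (G x t) not-common)

commonNeighbours≤1⇒complement-minor : ∀ {k} (G : Adj (suc (suc k))) {u v} → u ≢ v → G u v ≡ false →
                                      commonNeighbours G u v ≤ 1 → HasMinorMaxDeg≥ (complement G) (k ∸ 1)
commonNeighbours≤1⇒complement-minor G {u} {v} u≢v Guv few =
  dominating-edge⇒minor common u≢v (complement-adjacent G u≢v Guv) covered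
                        (subst (_≤ 1) (countV≡count common) few)
  where
  common : Fin _ → Bool
  common w = G u w ∧ G v w
  covered : ∀ t → t ≢ u → t ≢ v → complement G u t ≡ true ⊎ complement G v t ≡ true ⊎ common t ≡ true
  covered t t≢u t≢v with common t in common-t
  ... | true  = inj₂ (inj₂ refl)
  ... | false = Sum.map₂ inj₁ (non-common-neighbour G (≢-sym t≢u) (≢-sym t≢v) common-t)

far-vertex⇒complement-minor : ∀ {k} (G : Adj (suc (suc k))) {x y w a b} → x ≢ y → G x y ≡ false →
                              G x a ≡ true → G y a ≡ true → (∀ t → t ≢ a → t ≢ b → G x t ∧ G y t ≡ false) →
                              G x w ≡ false → G w a ≡ false → G w b ≡ false →
                              HasMinorMaxDeg≥ (complement G) (k ∸ 1)
far-vertex⇒complement-minor G {x} {y} {w} {a} {b} x≢y Gxy Gxa Gya only Gxw Gwa Gwb =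
  dominating-path⇒minor x≢w x≢y w≢y (complement-adjacent G x≢w Gxw) (inj₁ (complement-adjacent G x≢y Gxy))
                        covered
  where
  x≢w : x ≢ w
  x≢w = neighbour≢non-neighbour G Gxa Gwa
  w≢y : w ≢ y
  w≢y = ≢-sym (neighbour≢non-neighbour G Gya Gwa)
  covered : ∀ t → t ≢ x → t ≢ w → t ≢ y →
            complement G x t ≡ true ⊎ complement G w t ≡ true ⊎ complement G y t ≡ true
  covered t t≢x t≢w t≢y with t ≟ a | t ≟ b
  ... | yes refl | _        = inj₂ (inj₁ (complement-adjacent G (≢-sym t≢w) Gwa))
  ... | no _     | yes refl = inj₂ (inj₁ (complement-adjacent G (≢-sym t≢w) Gwb))
  ... | no t≢a   | no t≢b   = Sum.map₂ inj₂ (non-common-neighbour G (≢-sym t≢x) (≢-sym t≢y) (only t t≢a t≢b))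

dominating-neighbours⇒minor : ∀ {k} (G : Adj (suc (suc k))) → IsSimple G → ∀ {u a b} → a ≢ b →
                              G u a ≡ true → G u b ≡ true →
                              (∀ t → t ≢ a → t ≢ b → G t a ≡ true ⊎ G t b ≡ true) →
                              HasMinorMaxDeg≥ G (k ∸ 1)
dominating-neighbours⇒minor G simple {u} {a} {b} a≢b Gua Gub near =
  dominating-path⇒minor a≢u a≢b (adjacent⇒≢ simple Gub) (trans (symm a u) Gua) (inj₂ Gub) covered
  where
  open IsSimple simple
  a≢u : a ≢ u
  a≢u = ≢-sym (adjacent⇒≢ simple Gua)
  covered : ∀ t → t ≢ a → t ≢ u → t ≢ b → G a t ≡ true ⊎ G u t ≡ true ⊎ G b t ≡ true
  covered t t≢a _ t≢b = Sum.map (trans (symm a t)) (inj₂ ∘ trans (symm b t)) (near t t≢a t≢b)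

two-common-neighbours⇒minor : ∀ {k} (G : Adj (suc (suc k))) → IsSimple G → ∀ {u v a b} →
                              u ≢ v → G u v ≡ false → a ≢ b → G u a ≡ true → G v a ≡ true → G u b ≡ true →
                              (∀ t → t ≢ a → t ≢ b → G u t ∧ G v t ≡ false) →
                              HasMinorMaxDeg≥ G (k ∸ 1) ⊎ HasMinorMaxDeg≥ (complement G) (k ∸ 1)
two-common-neighbours⇒minor G simple {u} {v} {a} {b} u≢v Guv a≢b Gua Gva Gub only
  with any? (λ w → ¬? (w ≟ a) ×-dec ¬? (w ≟ b) ×-dec G w a ≟ᵇ false ×-dec G w b ≟ᵇ false)
... | yes (w , w≢a , w≢b , Gwa , Gwb) with ∧≡false (G u w) (only w w≢a w≢b)
...   | inj₁ Guw = inj₂ (far-vertex⇒complement-minor G u≢v Guv Gua Gva only Guw Gwa Gwb)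
...   | inj₂ Gvw = inj₂ (far-vertex⇒complement-minor G (≢-sym u≢v) (trans (IsSimple.symm simple v u) Guv) Gva Gua
                                                  (λ t t≢a t≢b → trans (∧-comm (G v t) (G u t)) (only t t≢a t≢b))
                                                  Gvw Gwa Gwb)
two-common-neighbours⇒minor G simple {u} {v} {a} {b} u≢v Guv a≢b Gua Gva Gub only | no no-far =
  inj₁ (dominating-neighbours⇒minor G simple a≢b Gua Gub near)
  where
  near : ∀ t → t ≢ a → t ≢ b → G t a ≡ true ⊎ G t b ≡ true
  near t t≢a t≢b with G t a in Gta | G t b in Gtb
  ... | true  | _     = inj₁ refl
  ... | false | true  = inj₂ refl
  ... | false | false = contradiction (t , t≢a , t≢b , Gta , Gtb) no-far

lemma3 : (n : ℕ) (G : Adj n) → IsSimple G → NonCompliant3 G →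
         (u v : Fin n) → u ≢ v → G u v ≡ false →
         3 ≤ commonNeighbours G u v
lemma3 (suc zero)    _ _      _                       zero zero u≢v _ = contradiction refl u≢v
lemma3 (suc (suc k)) G simple (no-minor , no-minorᶜ) u    v    u≢v Guv with 3 ≤? commonNeighbours G u v
... | yes three = three
... | no ¬three with m≤n⇒m<n∨m≡n (≤-pred (≰⇒> ¬three))
...   | inj₁ (s≤s at-most-one) = contradiction (commonNeighbours≤1⇒complement-minor G u≢v Guv at-most-one) no-minorᶜ
...   | inj₂ two with count≡2 (trans (sym (countV≡count (λ w → G u w ∧ G v w))) two)
...     | a , b , a≢b , common-a , common-b , only =
  ⊥-elim ([ no-minor , no-minorᶜ ]
            (two-common-neighbours⇒minor G simple u≢v Guv a≢b (∧-conicalˡ _ _ common-a) (∧-conicalʳ _ _ common-a)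
                                   (∧-conicalˡ _ _ common-b) only))
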